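{- Let $\sigma$ be a well-shaped state of type $(1,0,3,d_3)$. For every integer $0\le d\le d_3$ there exists a $4$-interval question $Q$ of type $[1,0,0,d]$ in $\sigma$ such that both resulting states $\sigma_{yes}$ and $\sigma_{no}$ are well shaped.
   Context: Setting: $\mathcal U=\{0,\dots,2^m-1\}$, viewed cyclically, and the game allows $3$ lies. States: a state is a map $\sigma:\mathcal U\to\{0,\dots,4\}$ of type $(|\sigma^{ -1}(0)|,\dots,|\sigma^{ -1}(3)|)$. Its support is $\Sigma=\{y:\sigma(y)\le3\}$. Answers: $\sigma_{yes}(y)=\min\{\sigma(y)+[y\notin Q],4\}$ and $\sigma_{no}(y)=\min\{\sigma(y)+[y\in Q],4\}$. Question type: the type of $Q$ in $\sigma$ is $[|Q\cap\sigma^{ -1}(i)|]_{i=0..3}$. Intervals: an interval is empty or a set of cyclically consecutive elements of $\mathcal U$. A $4$-interval question is a union of at most four intervals. Well shaped: order $\Sigma$ cyclically. The state is well shaped if $\Sigma$ splits into twelve possibly empty sets of cyclically consecutive elements of $\Sigma$, in cyclic order, on which $\sigma$ is constant with values either $2,1,0,1,2,3,2,1,2,3,2,3$ or $2,1,0,1,2,1,2,3,2,3,2,3$. -}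

module Defs where

open import Data.Nat using (ℕ; zero; suc; _+_; _∸_; _^_; _≤_; _<ᵇ_; _≡ᵇ_)
open import Data.Fin using (Fin; toℕ)
open import Data.Fin.Patterns using (0F; 1F; 2F; 3F; 4F)
open import Data.Bool using (Bool; true; false; if_then_else_; _∧_; _∨_; not)
open import Data.List using (List; []; _∷_; _++_; map; filterᵇ; length; replicate; drop; take; allFin)
open import Data.Vec using (Vec; toList)
open import Data.Product using (Σ; ∃; _×_; _,_)
open import Data.Sum using (_⊎_)
open import Relation.Binary.PropositionalEquality using (_≡_)

U : ℕ → Set
U m = Fin (2 ^ m)

State : ℕ → Set
State m = U m → Fin 5

Question : ℕ → Set
Question m = U m → Bool

bump : Fin 5 → Fin 5
bump 0F = 1F
bump 1F = 2F
bump 2F = 3F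
bump 3F = 4F
bump 4F = 4F

yesState : (m : ℕ) → State m → Question m → State m
yesState m σ Q y = if Q y then σ y else bump (σ y)

noState : (m : ℕ) → State m → Question m → State m
noState m σ Q y = if Q y then bump (σ y) else σ y

level : (m : ℕ) → State m → ℕ → ℕ
level m σ i = length (filterᵇ (λ y → toℕ (σ y) ≡ᵇ i) (allFin (2 ^ m)))

HasType : (m : ℕ) → State m → ℕ → ℕ → ℕ → ℕ → Set
HasType m σ a0 a1 a2 a3 =
  level m σ 0 ≡ a0 × level m σ 1 ≡ a1 × level m σ 2 ≡ a2 × level m σ 3 ≡ a3

qlevel : (m : ℕ) → State m → Question m → ℕ → ℕ
qlevel m σ Q i = length (filterᵇ (λ y → Q y ∧ (toℕ (σ y) ≡ᵇ i)) (allFin (2 ^ m)))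

QHasType : (m : ℕ) → State m → Question m → ℕ → ℕ → ℕ → ℕ → Set
QHasType m σ Q b0 b1 b2 b3 =
  qlevel m σ Q 0 ≡ b0 × qlevel m σ Q 1 ≡ b1 × qlevel m σ Q 2 ≡ b2 × qlevel m σ Q 3 ≡ b3

-- The cyclic interval of U starting at a with len elements:
-- {a, a+1, ..., a+len-1} mod 2^m  (empty when len = 0, all of U when len = 2^m).
inInterval : (m : ℕ) → U m → ℕ → U m → Bool
inInterval m a len y =
  (not (toℕ y <ᵇ toℕ a) ∧ (toℕ y <ᵇ toℕ a + len)) ∨ (toℕ y + 2 ^ m <ᵇ toℕ a + len)

record Interval (m : ℕ) : Set where
  constructor interval
  field
    start  : U m
    len    : ℕ
    len≤   : len ≤ 2 ^ m

inI : (m : ℕ) → Interval m → U m → Bool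
inI m (interval a l _) = inInterval m a l

-- Q is a union of at most four intervals (some possibly empty)
Is4Interval : (m : ℕ) → Question m → Set
Is4Interval m Q =
  Σ (Interval m) λ I₁ → Σ (Interval m) λ I₂ → Σ (Interval m) λ I₃ → Σ (Interval m) λ I₄ →
    ∀ y → Q y ≡ (if inI m I₁ y then true else if inI m I₂ y then true else
                 if inI m I₃ y then true else inI m I₄ y)

supportValues : (m : ℕ) → State m → List ℕ
supportValues m σ = filterᵇ (λ v → v <ᵇ 4) (map (λ y → toℕ (σ y)) (allFin (2 ^ m)))

rotate : ℕ → List ℕ → List ℕ
rotate r xs = drop r xs ++ take r xs

blocks : ∀ {n} → Vec ℕ n → Vec ℕ n → List ℕ
blocks ls vs = go (toList ls) (toList vs)
  where
  go : List ℕ → List ℕ → List ℕ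
  go (l ∷ ls) (v ∷ vs) = replicate l v ++ go ls vs
  go _ _ = []

pattern₁ : Vec ℕ 12
pattern₁ = 2 Data.Vec.∷ 1 Data.Vec.∷ 0 Data.Vec.∷ 1 Data.Vec.∷ 2 Data.Vec.∷ 3 Data.Vec.∷
           2 Data.Vec.∷ 1 Data.Vec.∷ 2 Data.Vec.∷ 3 Data.Vec.∷ 2 Data.Vec.∷ 3 Data.Vec.∷ Data.Vec.[]

pattern₂ : Vec ℕ 12
pattern₂ = 2 Data.Vec.∷ 1 Data.Vec.∷ 0 Data.Vec.∷ 1 Data.Vec.∷ 2 Data.Vec.∷ 1 Data.Vec.∷
           2 Data.Vec.∷ 3 Data.Vec.∷ 2 Data.Vec.∷ 3 Data.Vec.∷ 2 Data.Vec.∷ 3 Data.Vec.∷ Data.Vec.[]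

-- Well shaped: the support, read cyclically from some starting point, splits into
-- twelve (possibly empty) consecutive blocks on which σ takes the pattern's values.
WellShaped : (m : ℕ) → State m → Set
WellShaped m σ =
  ∃ λ (r : ℕ) → ∃ λ (ls : Vec ℕ 12) →
    (rotate r (supportValues m σ) ≡ blocks ls pattern₁)
    ⊎ (rotate r (supportValues m σ) ≡ blocks ls pattern₂)

-- Reading the support of σ cyclically from its unique 0 gives 0 2^b 3^c 2^e 3^f 2^g 3^h 2^a, since σ is
-- well shaped and has no 1.  Split d = d₁ + d₂ + d₃ with d₁ ≤ c, d₂ ≤ f, d₃ ≤ h and ask the 0 together with
-- the first d₁, d₂, d₃ positions of the three blocks of 3s; enumerating U cyclically from the 0, these are
-- four runs, hence four cyclic intervals of U.  After a yes every other support element gets one more lie: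
-- the 2s become 3s and the unasked 3s leave, so the support reads 0 3^K.  After a no the 0 becomes a 1 and
-- the asked 3s leave, giving 1 2^b 3^(c-d₁) 2^e 3^(f-d₂) 2^g 3^(h-d₃) 2^a.  Both are rotations of instances
-- of the first pattern.

module Submission where

open import Defs
open import Data.Nat using (ℕ; zero; suc; _+_; _∸_; _^_; _≤_; _<_; _<ᵇ_; _≡ᵇ_; _⊓_; _<?_; _≤?_; z≤n; s≤s; NonZero)
open import Data.Nat.DivMod using (_%_; m%n<n; m<n⇒m%n≡m; [m+n]%n≡m%n)
open import Data.Nat.Properties
open import Algebra.Properties.CommutativeSemigroup +-commutativeSemigroup using (xy∙z≈xz∙y)
open import Data.Fin using (Fin; toℕ; fromℕ<)
open import Data.Fin.Properties using (toℕ<n; toℕ-fromℕ<; toℕ-injective)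
open import Data.Fin.Patterns using (0F; 1F; 2F; 3F; 4F)
open import Data.Bool using (Bool; true; false; if_then_else_; _∧_; _∨_; not; T)
open import Data.Bool.Properties using (T-≡; ∨-identityʳ; ∧-zeroʳ)
open import Data.List using (List; []; _∷_; _++_; map; filterᵇ; length; replicate; drop; take;
  allFin; tabulate; applyUpTo; upTo; concat; concatMap)
open import Data.Nat.ListAction using (sum)
open import Data.Bool.ListAction using (any; or)
open import Data.List.Properties
open import Data.List.Relation.Unary.All as All using (All; []; _∷_)
open import Data.List.Relation.Unary.All.Properties using (++⁺; ++⁻ʳ)
open import Data.List.Relation.Binary.Pointwise using (Pointwise; []; _∷_)
open import Data.Vec as Vec using (Vec) renaming (_∷_ to _∷ᵥ_; [] to []ᵥ)
open import Data.Product using (Σ; ∃; ∃₂; _×_; _,_; proj₁; proj₂)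
open import Data.Sum using (_⊎_; inj₁; inj₂)
open import Function using (_∘_; id; Equivalence)
open import Relation.Nullary using (¬_; contradiction; yes; no)
open import Relation.Nullary.Decidable using (T?)
open import Relation.Binary.PropositionalEquality
open import Algebra.Solver.Monoid (++-monoid ℕ) using (solve; _⊕_; _⊜_) renaming (id to ∅)

private variable
  A B : Set

Rotation : List A → List A → Set
Rotation xs ys = ∃₂ λ u v → xs ≡ u ++ v × ys ≡ v ++ u

≡⇒rotation : {xs ys : List A} → xs ≡ ys → Rotation xs ys
≡⇒rotation {xs = xs} refl = [] , xs , refl , sym (++-identityʳ xs)

rotation-swap : (u v : List A) → Rotation (u ++ v) (v ++ u)
rotation-swap u v = u , v , refl , refl

rotation-drop-take : ∀ r (xs : List A) → Rotation xs (drop r xs ++ take r xs)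
rotation-drop-take r xs = take r xs , drop r xs , sym (take++drop≡id r xs) , refl

rotation-sym : {xs ys : List A} → Rotation xs ys → Rotation ys xs
rotation-sym (u , v , refl , refl) = v , u , refl , refl

++-equidivisible : ∀ (u v u′ v′ : List A) → u ++ v ≡ u′ ++ v′ →
  (∃ λ w → u′ ≡ u ++ w × v ≡ w ++ v′) ⊎ (∃ λ w → u ≡ u′ ++ w × v′ ≡ w ++ v)
++-equidivisible []      v u′       v′ eq = inj₁ (u′ , refl , eq)
++-equidivisible (x ∷ u) v []       v′ eq = inj₂ (x ∷ u , refl , sym eq)
++-equidivisible (x ∷ u) v (y ∷ u′) v′ eq with ∷-injective eq
... | refl , eq′ with ++-equidivisible u v u′ v′ eq′
... | inj₁ (w , refl , e) = inj₁ (w , refl , e)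
... | inj₂ (w , refl , e) = inj₂ (w , refl , e)

rotation-trans : {xs ys zs : List A} → Rotation xs ys → Rotation ys zs → Rotation xs zs
rotation-trans (u , v , refl , ys≡vu) (u′ , v′ , ys≡u′v′ , refl)
  with ++-equidivisible v u u′ v′ (trans (sym ys≡vu) ys≡u′v′)
... | inj₁ (w , refl , refl) = w , v′ ++ v , ++-assoc w v′ v , sym (++-assoc v′ v w)
... | inj₂ (w , refl , refl) = u ++ u′ , w , sym (++-assoc u u′ w) , ++-assoc w u u′

drop-length-++ : ∀ (u : List A) {n v} → length u ≡ n → drop n (u ++ v) ≡ v
drop-length-++ []      refl = refl
drop-length-++ (x ∷ u) refl = drop-length-++ u refl

take-length-++ : ∀ (u : List A) {n v} → length u ≡ n → take n (u ++ v) ≡ u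
take-length-++ []      refl = refl
take-length-++ (x ∷ u) refl = cong (x ∷_) (take-length-++ u refl)

rotation⇒rotate : {xs ys : List ℕ} → Rotation xs ys → ∃ λ r → rotate r xs ≡ ys
rotation⇒rotate (u , v , refl , refl) = length u , cong₂ _++_ (drop-length-++ u refl) (take-length-++ u refl)

rotation-map : ∀ (f : A → B) {xs ys} → Rotation xs ys → Rotation (map f xs) (map f ys)
rotation-map f (u , v , refl , refl) = map f u , map f v , map-++ f u v , map-++ f v u

rotation-filterᵇ : ∀ (p : A → Bool) {xs ys} → Rotation xs ys → Rotation (filterᵇ p xs) (filterᵇ p ys)
rotation-filterᵇ p (u , v , refl , refl) =
  filterᵇ p u , filterᵇ p v , filter-++ (T? ∘ p) u v , filter-++ (T? ∘ p) v u

ZeroFree : List ℕ → Set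
ZeroFree = All (λ x → ¬ x ≡ 0)

zero-split-unique : ∀ {x y u v} → ZeroFree x → ZeroFree y →
  x ++ 0 ∷ y ≡ u ++ 0 ∷ v → x ≡ u × y ≡ v
zero-split-unique {[]}    {u = []}    _ _ refl = refl , refl
zero-split-unique {[]}    {u = w ∷ u} _ ny eq with ∷-injective eq
... | refl , eq′ = contradiction refl (All.head (++⁻ʳ u (subst ZeroFree eq′ ny)))
zero-split-unique {z ∷ x} {u = []}    (nz ∷ _) _ eq = contradiction (∷-injectiveˡ eq) nz
zero-split-unique {z ∷ x} {u = w ∷ u} (_ ∷ nx) ny eq with ∷-injective eq
... | refl , eq′ with zero-split-unique nx ny eq′
... | refl , refl = refl , refl

rotation-from-zero : ∀ {x y z} → ZeroFree x → ZeroFree y → Rotation (x ++ 0 ∷ y) (0 ∷ z) → z ≡ y ++ x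
rotation-from-zero {z = z} nx ny (u , [] , e , refl)
  with zero-split-unique {u = []} nx ny (trans e (++-identityʳ (0 ∷ z)))
... | refl , refl = sym (++-identityʳ z)
rotation-from-zero nx ny (u , .0 ∷ v , e , refl) with zero-split-unique nx ny e
... | refl , refl = refl

++-cancel-length : ∀ {xs ys us vs : List A} → xs ++ ys ≡ us ++ vs → length xs ≡ length us → xs ≡ us × ys ≡ vs
++-cancel-length {xs = []}     {us = []}     eq _   = refl , eq
++-cancel-length {xs = []}     {us = _ ∷ _}  _  ()
++-cancel-length {xs = _ ∷ _}  {us = []}     _  ()
++-cancel-length {xs = x ∷ xs} {us = u ∷ us} eq len with ∷-injective eq
... | refl , eq′ with ++-cancel-length {xs = xs} {us = us} eq′ (suc-injective len)
... | refl , e = refl , e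

map-++-split : ∀ (f : A → B) xs {us vs} → map f xs ≡ us ++ vs →
  ∃₂ λ xs₁ xs₂ → xs ≡ xs₁ ++ xs₂ × map f xs₁ ≡ us × map f xs₂ ≡ vs
map-++-split f xs       {[]}     eq = [] , xs , refl , refl , eq
map-++-split f []       {_ ∷ _}  ()
map-++-split f (x ∷ xs) {u ∷ us} eq with ∷-injective eq
... | refl , eq′ with map-++-split f xs {us} eq′
... | xs₁ , xs₂ , refl , refl , refl = x ∷ xs₁ , xs₂ , refl , refl , refl

filterᵇ-++-split : ∀ (P : A → Bool) xs {us vs} → filterᵇ P xs ≡ us ++ vs →
  ∃₂ λ xs₁ xs₂ → xs ≡ xs₁ ++ xs₂ × filterᵇ P xs₁ ≡ us × filterᵇ P xs₂ ≡ vs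
filterᵇ-++-split P []       {[]}    eq = [] , [] , refl , refl , eq
filterᵇ-++-split P []       {_ ∷ _} ()
filterᵇ-++-split P (x ∷ xs) {us}    eq with P x in Px
filterᵇ-++-split P (x ∷ xs) {[]}     eq | true =
  [] , x ∷ xs , refl , refl , trans (filter-accept (T? ∘ P) (subst T (sym Px) _)) eq
filterᵇ-++-split P (x ∷ xs) {u ∷ us} eq | true with ∷-injective eq
... | refl , eq′ with filterᵇ-++-split P xs eq′
... | xs₁ , xs₂ , refl , e₁ , e₂ =
  x ∷ xs₁ , xs₂ , refl , trans (filter-accept (T? ∘ P) (subst T (sym Px) _)) (cong (x ∷_) e₁) , e₂
filterᵇ-++-split P (x ∷ xs) {us}     eq | false with filterᵇ-++-split P xs eq
... | xs₁ , xs₂ , refl , e₁ , e₂ =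
  x ∷ xs₁ , xs₂ , refl , trans (filter-reject (T? ∘ P) (subst T Px)) e₁ , e₂

replicate-+ : ∀ m n (x : A) → replicate (m + n) x ≡ replicate m x ++ replicate n x
replicate-+ zero    n x = refl
replicate-+ (suc m) n x = cong (x ∷_) (replicate-+ m n x)

replicate-+-++ : ∀ m n (x : A) ys → replicate m x ++ replicate n x ++ ys ≡ replicate (m + n) x ++ ys
replicate-+-++ m n x ys = trans (sym (++-assoc (replicate m x) _ ys)) (cong (_++ ys) (sym (replicate-+ m n x)))

concat-replicate : ∀ ns (x : A) → concat (map (λ n → replicate n x) ns) ≡ replicate (sum ns) x
concat-replicate []       x = refl
concat-replicate (n ∷ ns) x = trans (cong (replicate n x ++_) (concat-replicate ns x)) (sym (replicate-+ n (sum ns) x))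

length-filterᵇ-++ : ∀ (p : A → Bool) xs ys →
  length (filterᵇ p (xs ++ ys)) ≡ length (filterᵇ p xs) + length (filterᵇ p ys)
length-filterᵇ-++ p xs ys = trans (cong length (filter-++ (T? ∘ p) xs ys)) (length-++ (filterᵇ p xs))

length-filterᵇ-rotation : ∀ (p : A → Bool) {xs ys} → Rotation xs ys →
  length (filterᵇ p xs) ≡ length (filterᵇ p ys)
length-filterᵇ-rotation p (u , v , refl , refl) =
  trans (length-filterᵇ-++ p u v) (trans (+-comm (length (filterᵇ p u)) _) (sym (length-filterᵇ-++ p v u)))

length-filterᵇ-map : ∀ (p : B → Bool) (f : A → B) xs →
  length (filterᵇ (p ∘ f) xs) ≡ length (filterᵇ p (map f xs))
length-filterᵇ-map p f []       = refl
length-filterᵇ-map p f (x ∷ xs) with p (f x)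
... | true  = cong suc (length-filterᵇ-map p f xs)
... | false = length-filterᵇ-map p f xs

filterᵇ-witness : ∀ (P : A → Bool) xs {n} → length (filterᵇ P xs) ≡ suc n → ∃ λ x → P x ≡ true
filterᵇ-witness P (x ∷ xs) eq with P x in Px
... | true  = x , Px
... | false = filterᵇ-witness P xs eq

count : ℕ → List ℕ → ℕ
count k xs = length (filterᵇ (_≡ᵇ k) xs)

count-++ : ∀ k xs ys → count k (xs ++ ys) ≡ count k xs + count k ys
count-++ k = length-filterᵇ-++ (_≡ᵇ k)

count-replicate : ∀ k n v → count k (replicate n v) ≡ (if v ≡ᵇ k then n else 0)
count-replicate k zero    v with v ≡ᵇ k
... | true  = refl
... | false = refl
count-replicate k (suc n) v with v ≡ᵇ k | count-replicate k n v
... | true  | ih = cong suc ih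
... | false | ih = ih

count-blocks : ∀ {n} k (ls vs : Vec ℕ n) →
  count k (blocks ls vs) ≡ Vec.sum (Vec.zipWith (λ l v → if v ≡ᵇ k then l else 0) ls vs)
count-blocks k []ᵥ       []ᵥ       = refl
count-blocks k (l ∷ᵥ ls) (v ∷ᵥ vs) =
  trans (count-++ k (replicate l v) (blocks ls vs)) (cong₂ _+_ (count-replicate k l v) (count-blocks k ls vs))

count-filterᵇ-< : ∀ {k n} → k < n → ∀ xs → count k (filterᵇ (_<ᵇ n) xs) ≡ count k xs
count-filterᵇ-< k<n [] = refl
count-filterᵇ-< {k} {n} k<n (x ∷ xs) with x <ᵇ n in x<n
... | true with x ≡ᵇ k
...   | true  = cong suc (count-filterᵇ-< k<n xs)
...   | false = count-filterᵇ-< k<n xs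
count-filterᵇ-< {k} {n} k<n (x ∷ xs) | false with x ≡ᵇ k in x≡k
... | false = count-filterᵇ-< k<n xs
... | true  = contradiction
  (trans (sym x<n) (cong (_<ᵇ n) (≡ᵇ⇒≡ x k (subst T (sym x≡k) _))))
  (λ false≡k<ᵇn → subst T (sym false≡k<ᵇn) (<⇒<ᵇ k<n))

count-rotate : ∀ k r xs → count k (rotate r xs) ≡ count k xs
count-rotate k r xs = sym (length-filterᵇ-rotation (_≡ᵇ k) (rotation-drop-take r xs))

support : List (Fin 5) → List ℕ
support vs = filterᵇ (_<ᵇ 4) (map toℕ vs)

support-++ : ∀ vs ws → support (vs ++ ws) ≡ support vs ++ support ws
support-++ vs ws = trans (cong (filterᵇ (_<ᵇ 4)) (map-++ toℕ vs ws)) (filter-++ _ (map toℕ vs) (map toℕ ws))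

support-map-++ : ∀ m (τ : State m) xs ys → support (map τ (xs ++ ys)) ≡ support (map τ xs) ++ support (map τ ys)
support-map-++ m τ xs ys = trans (cong support (map-++ τ xs ys)) (support-++ (map τ xs) (map τ ys))

supportValues-allFin : ∀ m (τ : State m) → supportValues m τ ≡ support (map τ (allFin (2 ^ m)))
supportValues-allFin m τ = cong (filterᵇ (_<ᵇ 4)) (map-∘ (allFin (2 ^ m)))

supportValues-rotation : ∀ m (τ : State m) {xs} → Rotation (allFin (2 ^ m)) xs →
  Rotation (supportValues m τ) (support (map τ xs))
supportValues-rotation m τ {xs} rot =
  subst (λ s → Rotation s (support (map τ xs))) (sym (supportValues-allFin m τ))
        (rotation-filterᵇ (_<ᵇ 4) (rotation-map toℕ (rotation-map τ rot)))

count-support : ∀ m {k} → k < 4 → (τ : State m) (xs : List (U m)) →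
  length (filterᵇ (λ y → toℕ (τ y) ≡ᵇ k) xs) ≡ count k (support (map τ xs))
count-support m {k} k<4 τ xs = begin
  length (filterᵇ ((_≡ᵇ k) ∘ toℕ ∘ τ) xs)     ≡⟨ length-filterᵇ-map (_≡ᵇ k) (toℕ ∘ τ) xs ⟩
  count k (map (toℕ ∘ τ) xs)                 ≡⟨ cong (count k) (map-∘ xs) ⟩
  count k (map toℕ (map τ xs))               ≡⟨ count-filterᵇ-< k<4 (map toℕ (map τ xs)) ⟨
  count k (support (map τ xs))               ∎
  where open ≡-Reasoning

level≡count : ∀ m (σ : State m) {k} → k < 4 → level m σ k ≡ count k (supportValues m σ)
level≡count m σ k<4 =
  trans (count-support m k<4 σ (allFin (2 ^ m))) (cong (count _) (sym (supportValues-allFin m σ)))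

support-++-split : ∀ m (σ : State m) xs {us vs} → support (map σ xs) ≡ us ++ vs →
  ∃₂ λ xs₁ xs₂ → xs ≡ xs₁ ++ xs₂ × support (map σ xs₁) ≡ us × support (map σ xs₂) ≡ vs
support-++-split m σ xs eq with filterᵇ-++-split (_<ᵇ 4) (map toℕ (map σ xs)) eq
... | ws₁ , ws₂ , ws≡ , f₁ , f₂ with map-++-split (toℕ ∘ σ) xs {ws₁} {ws₂} (trans (map-∘ xs) ws≡)
... | xs₁ , xs₂ , refl , refl , refl =
  xs₁ , xs₂ , refl , trans (cong (filterᵇ (_<ᵇ 4)) (sym (map-∘ xs₁))) f₁ ,
                     trans (cong (filterᵇ (_<ᵇ 4)) (sym (map-∘ xs₂))) f₂

support-concat-split : ∀ m (σ : State m) xs s ss → support (map σ xs) ≡ concat (s ∷ ss) →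
  ∃ λ xss → xs ≡ concat xss × Pointwise (λ x v → support (map σ x) ≡ v) xss (s ∷ ss)
support-concat-split m σ xs s []        eq = xs ∷ [] , sym (++-identityʳ xs) , trans eq (++-identityʳ s) ∷ []
support-concat-split m σ xs s (s′ ∷ ss) eq with support-++-split m σ xs eq
... | xs₁ , xs₂ , refl , e₁ , e₂ with support-concat-split m σ xs₂ s′ ss e₂
... | xss , refl , pw = xs₁ ∷ xss , refl , e₁ ∷ pw

raise : List ℕ → List ℕ
raise []       = []
raise (v ∷ vs) = if v <ᵇ 3 then suc v ∷ raise vs else raise vs

support-map-bump : ∀ vs → support (map bump vs) ≡ raise (support vs)
support-map-bump []        = refl
support-map-bump (0F ∷ vs) = cong (1 ∷_) (support-map-bump vs)
support-map-bump (1F ∷ vs) = cong (2 ∷_) (support-map-bump vs)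
support-map-bump (2F ∷ vs) = cong (3 ∷_) (support-map-bump vs)
support-map-bump (3F ∷ vs) = support-map-bump vs
support-map-bump (4F ∷ vs) = support-map-bump vs

raise-++ : ∀ xs ys → raise (xs ++ ys) ≡ raise xs ++ raise ys
raise-++ []       ys = refl
raise-++ (x ∷ xs) ys with x <ᵇ 3
... | true  = cong (suc x ∷_) (raise-++ xs ys)
... | false = raise-++ xs ys

raise-2s : ∀ n → raise (replicate n 2) ≡ replicate n 3
raise-2s zero    = refl
raise-2s (suc n) = cong (3 ∷_) (raise-2s n)

raise-3s : ∀ n → raise (replicate n 3) ≡ []
raise-3s zero    = refl
raise-3s (suc n) = raise-3s n

raise-3s-2s : ∀ c e → raise (replicate c 3 ++ replicate e 2) ≡ replicate e 3
raise-3s-2s c e = trans (raise-++ (replicate c 3) (replicate e 2)) (cong₂ _++_ (raise-3s c) (raise-2s e))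

-- Well-shaped states with a single 0 and no 1

pattern₂₃ : Vec ℕ 6
pattern₂₃ = 2 ∷ᵥ 3 ∷ᵥ 2 ∷ᵥ 3 ∷ᵥ 2 ∷ᵥ 3 ∷ᵥ []ᵥ

twosThrees : ℕ → ℕ → ℕ → ℕ → ℕ → ℕ → List ℕ
twosThrees b c e f g h = blocks (b ∷ᵥ c ∷ᵥ e ∷ᵥ f ∷ᵥ g ∷ᵥ h ∷ᵥ []ᵥ) pattern₂₃

TwosThreesAfterZero : List ℕ → Set
TwosThreesAfterZero xs = ∃ λ a → ∃ λ b → ∃ λ c → ∃ λ e → ∃ λ f → ∃ λ g → ∃ λ h →
  Rotation xs (replicate a 2 ++ 0 ∷ twosThrees b c e f g h)

+≡0⇒zeros : ∀ x y z → x + (y + (z + 0)) ≡ 0 → x ≡ 0 × y ≡ 0 × z ≡ 0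
+≡0⇒zeros zero zero zero _ = refl , refl , refl

-- By count-blocks, the number of 1s in the blocks is l₁ + l₃ + l₇ (l₁ + l₃ + l₅ for pattern₂) and the
-- number of 0s is l₂.
blocks-single-0-no-1 : ∀ ls {xs} → xs ≡ blocks ls pattern₁ ⊎ xs ≡ blocks ls pattern₂ →
  count 0 xs ≡ 1 → count 1 xs ≡ 0 → TwosThreesAfterZero xs
blocks-single-0-no-1 ls@(l₀ ∷ᵥ l₁ ∷ᵥ l₂ ∷ᵥ l₃ ∷ᵥ l₄ ∷ᵥ l₅ ∷ᵥ l₆ ∷ᵥ l₇ ∷ᵥ l₈ ∷ᵥ l₉ ∷ᵥ l₁₀ ∷ᵥ l₁₁ ∷ᵥ []ᵥ) (inj₁ refl) one-0 no-1
  with +≡0⇒zeros l₁ l₃ l₇ (trans (sym (count-blocks 1 ls pattern₁)) no-1)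
... | refl , refl , refl with trans (sym (+-identityʳ l₂)) (trans (sym (count-blocks 0 ls pattern₁)) one-0)
... | refl = l₀ , l₄ , l₅ , l₆ + l₈ , l₉ , l₁₀ , l₁₁ , ≡⇒rotation
  (cong (λ z → replicate l₀ 2 ++ 0 ∷ replicate l₄ 2 ++ replicate l₅ 3 ++ z) (replicate-+-++ l₆ l₈ 2 _))
blocks-single-0-no-1 ls@(l₀ ∷ᵥ l₁ ∷ᵥ l₂ ∷ᵥ l₃ ∷ᵥ l₄ ∷ᵥ l₅ ∷ᵥ l₆ ∷ᵥ l₇ ∷ᵥ l₈ ∷ᵥ l₉ ∷ᵥ l₁₀ ∷ᵥ l₁₁ ∷ᵥ []ᵥ) (inj₂ refl) one-0 no-1
  with +≡0⇒zeros l₁ l₃ l₅ (trans (sym (count-blocks 1 ls pattern₂)) no-1)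
... | refl , refl , refl with trans (sym (+-identityʳ l₂)) (trans (sym (count-blocks 0 ls pattern₂)) one-0)
... | refl = l₀ , l₄ + l₆ , l₇ , l₈ , l₉ , l₁₀ , l₁₁ , ≡⇒rotation
  (cong (λ z → replicate l₀ 2 ++ 0 ∷ z) (replicate-+-++ l₄ l₆ 2 _))

wellShaped-single-0-no-1 : ∀ m (σ : State m) → WellShaped m σ →
  count 0 (supportValues m σ) ≡ 1 → count 1 (supportValues m σ) ≡ 0 →
  TwosThreesAfterZero (supportValues m σ)
wellShaped-single-0-no-1 m σ (r , ls , shaped) one-0 no-1
  with blocks-single-0-no-1 ls shaped (trans (count-rotate 0 r (supportValues m σ)) one-0)
                                      (trans (count-rotate 1 r (supportValues m σ)) no-1)
... | a , b , c , e , f , g , h , rot =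
  a , b , c , e , f , g , h , rotation-trans (rotation-drop-take r (supportValues m σ)) rot

replicate-zeroFree : ∀ n k → ZeroFree (replicate n (suc k))
replicate-zeroFree zero    k = []
replicate-zeroFree (suc n) k = (λ ()) ∷ replicate-zeroFree n k

twosThrees-zeroFree : ∀ b c e f g h → ZeroFree (twosThrees b c e f g h)
twosThrees-zeroFree b c e f g h =
  ++⁺ (replicate-zeroFree b 1) (++⁺ (replicate-zeroFree c 2) (++⁺ (replicate-zeroFree e 1)
  (++⁺ (replicate-zeroFree f 2) (++⁺ (replicate-zeroFree g 1) (++⁺ (replicate-zeroFree h 2) [])))))

level-3-after-zero : ∀ m (σ : State m) a b c e f g h →
  Rotation (supportValues m σ) (replicate a 2 ++ 0 ∷ twosThrees b c e f g h) → level m σ 3 ≡ c + (f + h)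
level-3-after-zero m σ a b c e f g h rot = begin
  level m σ 3                                                 ≡⟨ level≡count m σ (s≤s (s≤s (s≤s (s≤s z≤n)))) ⟩
  count 3 (supportValues m σ)                                 ≡⟨ length-filterᵇ-rotation (_≡ᵇ 3) rot ⟩
  count 3 (replicate a 2 ++ 0 ∷ twosThrees b c e f g h)       ≡⟨ count-++ 3 (replicate a 2) _ ⟩
  count 3 (replicate a 2) + count 3 (twosThrees b c e f g h)  ≡⟨ cong₂ _+_ (count-replicate 3 a 2)
                                                                    (count-blocks 3 (b ∷ᵥ c ∷ᵥ e ∷ᵥ f ∷ᵥ g ∷ᵥ h ∷ᵥ []ᵥ) pattern₂₃) ⟩
  c + (f + (h + 0))                                           ≡⟨ cong (λ z → c + (f + z)) (+-identityʳ h) ⟩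
  c + (f + h)                                                 ∎
  where open ≡-Reasoning

zero-position : ∀ m (σ : State m) {n} → level m σ 0 ≡ suc n → ∃ λ p → σ p ≡ 0F
zero-position m σ level₀ with filterᵇ-witness (λ y → toℕ (σ y) ≡ᵇ 0) (allFin (2 ^ m)) level₀
... | p , σp≡ᵇ0 = p , toℕ-injective (≡ᵇ⇒≡ (toℕ (σ p)) 0 (subst T (sym σp≡ᵇ0) _))

-- Cyclic intervals

Range : Set
Range = ℕ × ℕ

inRange : Range → ℕ → Bool
inRange (s , t) x = not (x <ᵇ s) ∧ (x <ᵇ s + t)

<ᵇ-true : ∀ {m n} → m < n → (m <ᵇ n) ≡ true
<ᵇ-true m<n = Equivalence.to T-≡ (<⇒<ᵇ m<n)

<ᵇ-false : ∀ {m n} → n ≤ m → (m <ᵇ n) ≡ false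
<ᵇ-false {m} {n} n≤m with m <ᵇ n in m<ᵇn
... | false = refl
... | true  = contradiction (<ᵇ⇒< m n (subst T (sym m<ᵇn) _)) (≤⇒≯ n≤m)

+-<ᵇ-cancelˡ : ∀ k m n → (k + m <ᵇ k + n) ≡ (m <ᵇ n)
+-<ᵇ-cancelˡ zero    m n = refl
+-<ᵇ-cancelˡ (suc k) m n = +-<ᵇ-cancelˡ k m n

+-<ᵇ-cancelʳ : ∀ k m n → (m + k <ᵇ n + k) ≡ (m <ᵇ n)
+-<ᵇ-cancelʳ k m n = trans (cong₂ _<ᵇ_ (+-comm m k) (+-comm n k)) (+-<ᵇ-cancelˡ k m n)

m+n+o≤p+n⇒m+o≤p : ∀ a {N t p} → a + N + t ≤ p + N → a + t ≤ p
m+n+o≤p+n⇒m+o≤p a {N} {t} {p} le = +-cancelʳ-≤ N (a + t) p (subst (_≤ p + N) (xy∙z≈xz∙y a N t) le)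

-- Defs tests membership of y in the cyclic interval [a, a + t) by also trying y + N.  Within a window
-- [p, p + N) every residue mod N has exactly one representative, and there the test becomes an ordinary
-- interval test on the representatives â of a and ŷ of y.
inInterval-window : ∀ {N p a t y â ŷ} → a < N → y < N →
  p ≤ â → â + t ≤ p + N → p ≤ ŷ → ŷ < p + N →
  â ≡ a ⊎ â ≡ a + N → ŷ ≡ y ⊎ ŷ ≡ y + N →
  (inRange (a , t) y ∨ (y + N <ᵇ a + t)) ≡ inRange (â , t) ŷ
inInterval-window {N} {p} {a} {t} {y} a<N y<N p≤â â+t≤ p≤ŷ ŷ< (inj₁ refl) (inj₁ refl)
  rewrite <ᵇ-false {y + N} {a + t} (≤-trans â+t≤ (+-monoˡ-≤ N p≤ŷ)) = ∨-identityʳ _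
inInterval-window {N} {p} {a} {t} {y} a<N y<N p≤â â+t≤ p≤ŷ ŷ< (inj₁ refl) (inj₂ refl)
  rewrite <ᵇ-true {y} {a} (<-≤-trans (+-cancelʳ-< N y p ŷ<) p≤â)
        | <ᵇ-false {y + N} {a} (≤-trans (<⇒≤ a<N) (m≤n+m N y)) = refl
inInterval-window {N} {p} {a} {t} {y} a<N y<N p≤â a+N+t≤ p≤ŷ ŷ< (inj₂ refl) (inj₁ refl)
  rewrite <ᵇ-true {y} {a + N} (<-≤-trans y<N (m≤n+m N a))
        | <ᵇ-false {y} {a + t} (≤-trans (m+n+o≤p+n⇒m+o≤p a a+N+t≤) p≤ŷ)
        | <ᵇ-false {y + N} {a + t} (≤-trans (≤-trans (m+n+o≤p+n⇒m+o≤p a a+N+t≤) p≤ŷ) (m≤m+n y N))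
        | ∧-zeroʳ (not (y <ᵇ a)) = refl
inInterval-window {N} {p} {a} {t} {y} a<N y<N p≤â a+N+t≤ p≤ŷ ŷ< (inj₂ refl) (inj₂ refl)
  rewrite <ᵇ-false {y + N} {a + t} (≤-trans (m+n+o≤p+n⇒m+o≤p a a+N+t≤) p≤ŷ) = begin
    inRange (a , t) y ∨ false                  ≡⟨ ∨-identityʳ _ ⟩
    not (y <ᵇ a) ∧ (y <ᵇ a + t)                ≡⟨ cong₂ (λ u v → not u ∧ v) (+-<ᵇ-cancelʳ N y a) (+-<ᵇ-cancelʳ N y (a + t)) ⟨
    not (y + N <ᵇ a + N) ∧ (y + N <ᵇ a + t + N) ≡⟨ cong (λ z → not (y + N <ᵇ a + N) ∧ (y + N <ᵇ z)) (xy∙z≈xz∙y a N t) ⟨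
    inRange (a + N , t) (y + N)                ∎
  where open ≡-Reasoning

m<n+n⇒m≡m%n⊎m≡m%n+n : ∀ {x N} .{{_ : NonZero N}} → x < N + N → x ≡ x % N ⊎ x ≡ x % N + N
m<n+n⇒m≡m%n⊎m≡m%n+n {x} {N} x<2N with x <? N
... | yes x<N = inj₁ (sym (m<n⇒m%n≡m x<N))
... | no  x≮N = inj₂ (trans (sym (m∸n+n≡m N≤x)) (cong (_+ N) (sym x%N≡x∸N)))
  where
  N≤x = ≮⇒≥ x≮N
  x∸N<N : x ∸ N < N
  x∸N<N = +-cancelʳ-< N (x ∸ N) N (subst (_< N + N) (sym (m∸n+n≡m N≤x)) x<2N)
  x%N≡x∸N : x % N ≡ x ∸ N
  x%N≡x∸N = trans (cong (_% N) (sym (m∸n+n≡m N≤x))) (trans ([m+n]%n≡m%n (x ∸ N) N) (m<n⇒m%n≡m x∸N<N))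

module _ (m : ℕ) where

  private instance
    2^m-nonZero : NonZero (2 ^ m)
    2^m-nonZero = m^n≢0 2 m

  cyclicInterval : Range → Interval m
  cyclicInterval (x , t) = interval (fromℕ< (m%n<n x (2 ^ m))) (t ⊓ 2 ^ m) (m⊓n≤n t (2 ^ m))

  -- the representative of y in the window [p, p + 2^m)
  lift : U m → U m → ℕ
  lift p y = if toℕ y <ᵇ toℕ p then toℕ y + 2 ^ m else toℕ y

  lift-cases : ∀ p y → lift p y ≡ toℕ y ⊎ lift p y ≡ toℕ y + 2 ^ m
  lift-cases p y with toℕ y <ᵇ toℕ p
  ... | true  = inj₂ refl
  ... | false = inj₁ refl

  lift-window : ∀ p y → toℕ p ≤ lift p y × lift p y < toℕ p + 2 ^ m
  lift-window p y with toℕ y <ᵇ toℕ p in y<ᵇp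
  ... | true  = ≤-trans (<⇒≤ (toℕ<n p)) (m≤n+m (2 ^ m) (toℕ y)) ,
                +-monoˡ-< (2 ^ m) (<ᵇ⇒< (toℕ y) (toℕ p) (subst T (sym y<ᵇp) _))
  ... | false = ≮⇒≥ (λ y<p → subst T y<ᵇp (<⇒<ᵇ y<p)) ,
                <-≤-trans (toℕ<n y) (m≤n+m (2 ^ m) (toℕ p))

  inI-cyclicInterval : ∀ p y {x t} → toℕ p ≤ x → x + t ≤ toℕ p + 2 ^ m →
    inI m (cyclicInterval (x , t)) y ≡ inRange (x , t) (lift p y)
  inI-cyclicInterval p y {x} {t} p≤x x+t≤ = trans
    (cong₂ (λ a l → inRange (a , l) (toℕ y) ∨ (toℕ y + 2 ^ m <ᵇ a + l))
           (toℕ-fromℕ< (m%n<n x (2 ^ m))) (m≤n⇒m⊓n≡m t≤N))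
    (inInterval-window (m%n<n x (2 ^ m)) (toℕ<n y) p≤x x+t≤ (proj₁ (lift-window p y)) (proj₂ (lift-window p y))
      (m<n+n⇒m≡m%n⊎m≡m%n+n x<2N) (lift-cases p y))
    where
    t≤N : t ≤ 2 ^ m
    t≤N = +-cancelˡ-≤ (toℕ p) t (2 ^ m) (≤-trans (+-monoˡ-≤ t p≤x) x+t≤)
    x<2N : x < 2 ^ m + 2 ^ m
    x<2N = ≤-<-trans (≤-trans (m≤m+n x t) x+t≤) (+-monoˡ-< (2 ^ m) (toℕ<n p))

applyUpTo-+ : ∀ (f : ℕ → A) m n → applyUpTo f (m + n) ≡ applyUpTo f m ++ applyUpTo (f ∘ (m +_)) n
applyUpTo-+ f zero    n = refl
applyUpTo-+ f (suc m) n = cong (f 0 ∷_) (applyUpTo-+ (f ∘ suc) m n)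

applyUpTo-cong : ∀ {f g : ℕ → A} n → (∀ {i} → i < n → f i ≡ g i) → applyUpTo f n ≡ applyUpTo g n
applyUpTo-cong zero    f≡g = refl
applyUpTo-cong (suc n) f≡g = cong₂ _∷_ (f≡g (s≤s z≤n)) (applyUpTo-cong n (f≡g ∘ s≤s))

applyUpTo-replicate : ∀ {f : ℕ → A} {x} n → (∀ {i} → i < n → f i ≡ x) → applyUpTo f n ≡ replicate n x
applyUpTo-replicate zero    f≡x = refl
applyUpTo-replicate (suc n) f≡x = cong₂ _∷_ (f≡x (s≤s z≤n)) (applyUpTo-replicate n (f≡x ∘ s≤s))

tabulate-toℕ : ∀ n (f : ℕ → A) → tabulate {n = n} (f ∘ toℕ) ≡ applyUpTo f n
tabulate-toℕ zero    f = refl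
tabulate-toℕ (suc n) f = cong (f 0 ∷_) (tabulate-toℕ n (f ∘ suc))

map-toℕ-allFin : ∀ n → map toℕ (allFin n) ≡ upTo n
map-toℕ-allFin n = trans (map-tabulate {n = n} id toℕ) (tabulate-toℕ n id)

module _ (m : ℕ) (p : U m) where

  fromPosition : List (U m)
  fromPosition = drop (toℕ p) (allFin (2 ^ m)) ++ take (toℕ p) (allFin (2 ^ m))

  rotation-fromPosition : Rotation (allFin (2 ^ m)) fromPosition
  rotation-fromPosition = rotation-drop-take (toℕ p) (allFin (2 ^ m))

  map-toℕ-fromPosition : map toℕ fromPosition ≡ applyUpTo (toℕ p +_) (2 ^ m ∸ toℕ p) ++ upTo (toℕ p)
  map-toℕ-fromPosition = begin
    map toℕ fromPosition
      ≡⟨ map-++ toℕ (drop (toℕ p) (allFin N)) _ ⟩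
    map toℕ (drop (toℕ p) (allFin N)) ++ map toℕ (take (toℕ p) (allFin N))
      ≡⟨ cong₂ _++_ (drop-map (toℕ p) (allFin N)) (take-map (toℕ p) (allFin N)) ⟨
    drop (toℕ p) (map toℕ (allFin N)) ++ take (toℕ p) (map toℕ (allFin N))
      ≡⟨ cong (λ xs → drop (toℕ p) xs ++ take (toℕ p) xs) (trans (map-toℕ-allFin N) upTo-split) ⟩
    drop (toℕ p) (upTo (toℕ p) ++ rest) ++ take (toℕ p) (upTo (toℕ p) ++ rest)
      ≡⟨ cong₂ _++_ (drop-length-++ (upTo (toℕ p)) (length-upTo (toℕ p)))
                    (take-length-++ (upTo (toℕ p)) (length-upTo (toℕ p))) ⟩
    rest ++ upTo (toℕ p) ∎
    where
    open ≡-Reasoning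
    N = 2 ^ m
    rest = applyUpTo (toℕ p +_) (N ∸ toℕ p)
    upTo-split : upTo N ≡ upTo (toℕ p) ++ rest
    upTo-split = trans (cong upTo (sym (m+[n∸m]≡n (<⇒≤ (toℕ<n p))))) (applyUpTo-+ id (toℕ p) (N ∸ toℕ p))

  map-lift-fromPosition : map (lift m p) fromPosition ≡ applyUpTo (toℕ p +_) (2 ^ m)
  map-lift-fromPosition = begin
    map (lift m p) fromPosition
      ≡⟨ map-∘ fromPosition ⟩
    map liftℕ (map toℕ fromPosition)
      ≡⟨ cong (map liftℕ) map-toℕ-fromPosition ⟩
    map liftℕ (applyUpTo (P +_) (N ∸ P) ++ upTo P)
      ≡⟨ map-++ liftℕ (applyUpTo (P +_) (N ∸ P)) (upTo P) ⟩
    map liftℕ (applyUpTo (P +_) (N ∸ P)) ++ map liftℕ (upTo P)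
      ≡⟨ cong₂ _++_ (map-applyUpTo (P +_) liftℕ (N ∸ P)) (map-upTo liftℕ P) ⟩
    applyUpTo (liftℕ ∘ (P +_)) (N ∸ P) ++ applyUpTo liftℕ P
      ≡⟨ cong₂ _++_ (applyUpTo-cong (N ∸ P) (λ _ → lift-above _)) (applyUpTo-cong P lift-below) ⟩
    applyUpTo (P +_) (N ∸ P) ++ applyUpTo ((P +_) ∘ ((N ∸ P) +_)) P
      ≡⟨ applyUpTo-+ (P +_) (N ∸ P) P ⟨
    applyUpTo (P +_) (N ∸ P + P)
      ≡⟨ cong (applyUpTo (P +_)) (m∸n+n≡m (<⇒≤ (toℕ<n p))) ⟩
    applyUpTo (P +_) N ∎
    where
    open ≡-Reasoning
    N = 2 ^ m
    P = toℕ p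
    liftℕ : ℕ → ℕ
    liftℕ x = if x <ᵇ P then x + N else x
    lift-above : ∀ i → liftℕ (P + i) ≡ P + i
    lift-above i rewrite <ᵇ-false {P + i} {P} (m≤m+n P i) = refl
    lift-below : ∀ {i} → i < P → liftℕ i ≡ P + (N ∸ P + i)
    lift-below {i} i<P rewrite <ᵇ-true i<P = begin
      i + N             ≡⟨ +-comm i N ⟩
      N + i             ≡⟨ cong (_+ i) (m+[n∸m]≡n (<⇒≤ (toℕ<n p))) ⟨
      P + (N ∸ P) + i   ≡⟨ +-assoc P (N ∸ P) i ⟩
      P + (N ∸ P + i)   ∎

  fromPosition-head : ∃ λ Z → fromPosition ≡ p ∷ Z
  fromPosition-head with 2 ^ m ∸ toℕ p | m<n⇒0<n∸m (toℕ<n p) | fromPosition | map-toℕ-fromPosition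
  ... | suc _ | _ | z ∷ Z | eq =
    Z , cong (_∷ Z) (toℕ-injective (trans (∷-injectiveˡ eq) (+-identityʳ (toℕ p))))

length-fromPosition : ∀ m p → length (fromPosition m p) ≡ 2 ^ m
length-fromPosition m p = trans (sym (length-map (lift m p) (fromPosition m p)))
  (trans (cong length (map-lift-fromPosition m p)) (length-applyUpTo (toℕ p +_) (2 ^ m)))

wellShaped-from : ∀ m (τ : State m) p ls → Rotation (support (map τ (fromPosition m p))) (blocks ls pattern₁) →
  WellShaped m τ
wellShaped-from m τ p ls rot
  with rotation⇒rotate (rotation-trans (supportValues-rotation m τ (rotation-fromPosition m p)) rot)
... | r , shaped = r , ls , inj₁ shaped

support-after-zero : ∀ m (σ : State m) p Z → σ p ≡ 0F → fromPosition m p ≡ p ∷ Z →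
  ∀ a b c e f g h → Rotation (supportValues m σ) (replicate a 2 ++ 0 ∷ twosThrees b c e f g h) →
  support (map σ Z) ≡ twosThrees b c e f g h ++ replicate a 2
support-after-zero m σ p Z σp≡0 fromP a b c e f g h rot =
  rotation-from-zero (replicate-zeroFree a 1) (twosThrees-zeroFree b c e f g h)
    (rotation-trans (rotation-sym rot) (subst (Rotation (supportValues m σ)) read-from-p
                                              (supportValues-rotation m σ (rotation-fromPosition m p))))
  where
  read-from-p : support (map σ (fromPosition m p)) ≡ 0 ∷ support (map σ Z)
  read-from-p rewrite fromP | σp≡0 = refl

-- Questions made of runs

runsMask : List (ℕ × ℕ) → List Bool
runsMask []             = []
runsMask ((t , f) ∷ rs) = replicate t true ++ replicate f false ++ runsMask rs

runsLength : List (ℕ × ℕ) → ℕ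
runsLength []             = 0
runsLength ((t , f) ∷ rs) = t + (f + runsLength rs)

length-runsMask : ∀ rs → length (runsMask rs) ≡ runsLength rs
length-runsMask []             = refl
length-runsMask ((t , f) ∷ rs) = begin
  length (replicate t true ++ replicate f false ++ runsMask rs)
    ≡⟨ length-++ (replicate t true) ⟩
  length (replicate t true) + length (replicate f false ++ runsMask rs)
    ≡⟨ cong₂ _+_ (length-replicate t)
                 (trans (length-++ (replicate f false)) (cong₂ _+_ (length-replicate f) (length-runsMask rs))) ⟩
  t + (f + runsLength rs) ∎
  where open ≡-Reasoning

askedRanges : ℕ → List (ℕ × ℕ) → List Range
askedRanges c []             = []
askedRanges c ((t , f) ∷ rs) = (c , t) ∷ askedRanges (c + (t + f)) rs

inRanges : List Range → ℕ → Bool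
inRanges rgs x = any (λ r → inRange r x) rgs

inRanges-below : ∀ {x c} rs → x < c → inRanges (askedRanges c rs) x ≡ false
inRanges-below                  []             x<c = refl
inRanges-below {x} {c} ((t , f) ∷ rs) x<c
  rewrite <ᵇ-true x<c = inRanges-below rs (<-≤-trans x<c (m≤m+n c (t + f)))

askedRanges-within : ∀ c rs →
  All (λ r → c ≤ proj₁ r × proj₁ r + proj₂ r ≤ c + runsLength rs) (askedRanges c rs)
askedRanges-within c []             = []
askedRanges-within c ((t , f) ∷ rs) =
  (≤-refl , +-monoʳ-≤ c (m≤m+n t (f + runsLength rs))) ∷
  All.map (λ (c′≤s , s+t≤) → ≤-trans (m≤m+n c (t + f)) c′≤s , ≤-trans s+t≤ (≤-reflexive (end-assoc c t f)))
          (askedRanges-within (c + (t + f)) rs)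
  where
  end-assoc : ∀ c t f → c + (t + f) + runsLength rs ≡ c + (t + (f + runsLength rs))
  end-assoc c t f = trans (+-assoc c (t + f) _) (cong (c +_) (+-assoc t f _))

map-inRanges : ∀ c rs → map (inRanges (askedRanges c rs)) (applyUpTo (c +_) (runsLength rs)) ≡ runsMask rs
map-inRanges c []             = refl
map-inRanges c ((t , f) ∷ rs) = begin
  map g (applyUpTo (c +_) (t + (f + L)))
    ≡⟨ map-applyUpTo (c +_) g (t + (f + L)) ⟩
  applyUpTo (g ∘ (c +_)) (t + (f + L))
    ≡⟨ applyUpTo-+ (g ∘ (c +_)) t (f + L) ⟩
  applyUpTo (g ∘ (c +_)) t ++ applyUpTo (λ i → g (c + (t + i))) (f + L)
    ≡⟨ cong (applyUpTo (g ∘ (c +_)) t ++_) (applyUpTo-+ (λ i → g (c + (t + i))) f L) ⟩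
  applyUpTo (g ∘ (c +_)) t ++ applyUpTo (λ i → g (c + (t + i))) f ++ applyUpTo (λ i → g (c + (t + (f + i)))) L
    ≡⟨ cong₂ _++_ (applyUpTo-replicate t asked) (cong₂ _++_ (applyUpTo-replicate f unasked) later) ⟩
  replicate t true ++ replicate f false ++ runsMask rs ∎
  where
  open ≡-Reasoning
  L = runsLength rs
  c′ = c + (t + f)
  g = inRanges (askedRanges c ((t , f) ∷ rs))
  asked : ∀ {i} → i < t → g (c + i) ≡ true
  asked {i} i<t rewrite <ᵇ-false {c + i} {c} (m≤m+n c i) | +-<ᵇ-cancelˡ c i t | <ᵇ-true i<t = refl
  unasked : ∀ {i} → i < f → g (c + (t + i)) ≡ false
  unasked {i} i<f
    rewrite <ᵇ-false {c + (t + i)} {c} (m≤m+n c (t + i))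
          | +-<ᵇ-cancelˡ c (t + i) t | <ᵇ-false {t + i} {t} (m≤m+n t i)
    = inRanges-below rs (+-monoʳ-< c (+-monoʳ-< t i<f))
  shift : ∀ i → c + (t + (f + i)) ≡ c′ + i
  shift i = trans (cong (c +_) (sym (+-assoc t f i))) (sym (+-assoc c (t + f) i))
  later : applyUpTo (λ i → g (c + (t + (f + i)))) L ≡ runsMask rs
  later = begin
    applyUpTo (λ i → g (c + (t + (f + i)))) L
      ≡⟨ applyUpTo-cong L (λ {i} _ → cong g (shift i)) ⟩
    applyUpTo (g ∘ (c′ +_)) L
      ≡⟨ applyUpTo-cong L (λ {i} _ → beyond i) ⟩
    applyUpTo (inRanges (askedRanges c′ rs) ∘ (c′ +_)) L
      ≡⟨ map-applyUpTo (c′ +_) (inRanges (askedRanges c′ rs)) L ⟨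
    map (inRanges (askedRanges c′ rs)) (applyUpTo (c′ +_) L)
      ≡⟨ map-inRanges c′ rs ⟩
    runsMask rs ∎
    where
    beyond : ∀ i → g (c′ + i) ≡ inRanges (askedRanges c′ rs) (c′ + i)
    beyond i rewrite <ᵇ-false {c′ + i} {c} (≤-trans (m≤m+n c (t + f)) (m≤m+n c′ i))
                   | <ᵇ-false {c′ + i} {c + t} (≤-trans (+-monoʳ-≤ c (m≤m+n t f)) (m≤m+n c′ i)) = refl

runsQuestion : (m : ℕ) → U m → List (ℕ × ℕ) → Question m
runsQuestion m p rs y = any (λ I → inI m I y) (map (cyclicInterval m) (askedRanges (toℕ p) rs))

map-runsQuestion : ∀ m p rs → runsLength rs ≡ 2 ^ m →
  map (runsQuestion m p rs) (fromPosition m p) ≡ runsMask rs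
map-runsQuestion m p rs L≡N = begin
  map (runsQuestion m p rs) (fromPosition m p)
    ≡⟨ map-cong via-lift (fromPosition m p) ⟩
  map (inRanges (askedRanges (toℕ p) rs) ∘ lift m p) (fromPosition m p)
    ≡⟨ map-∘ (fromPosition m p) ⟩
  map (inRanges (askedRanges (toℕ p) rs)) (map (lift m p) (fromPosition m p))
    ≡⟨ cong (map (inRanges (askedRanges (toℕ p) rs))) (map-lift-fromPosition m p) ⟩
  map (inRanges (askedRanges (toℕ p) rs)) (applyUpTo (toℕ p +_) (2 ^ m))
    ≡⟨ cong (λ n → map (inRanges (askedRanges (toℕ p) rs)) (applyUpTo (toℕ p +_) n)) L≡N ⟨
  map (inRanges (askedRanges (toℕ p) rs)) (applyUpTo (toℕ p +_) (runsLength rs))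
    ≡⟨ map-inRanges (toℕ p) rs ⟩
  runsMask rs ∎
  where
  open ≡-Reasoning
  via-lift : ∀ y → runsQuestion m p rs y ≡ inRanges (askedRanges (toℕ p) rs) (lift m p y)
  via-lift y = trans (cong or (sym (map-∘ (askedRanges (toℕ p) rs))))
    (cong or (map-cong-local (All.map
      (λ (p≤s , s+t≤) → inI-cyclicInterval m p y p≤s (subst (λ n → _ ≤ toℕ p + n) L≡N s+t≤))
      (askedRanges-within (toℕ p) rs))))

any-4Interval : ∀ m (Is : List (Interval m)) → length Is ≡ 4 → Is4Interval m (λ y → any (λ I → inI m I y) Is)
any-4Interval m (I₁ ∷ I₂ ∷ I₃ ∷ I₄ ∷ []) refl =
  I₁ , I₂ , I₃ , I₄ , λ y → or-as-if (inI m I₁ y) (inI m I₂ y) (inI m I₃ y) (inI m I₄ y)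
  where
  or-as-if : ∀ a b c d →
    a ∨ (b ∨ (c ∨ (d ∨ false))) ≡ (if a then true else if b then true else if c then true else d)
  or-as-if true  b     c     d = refl
  or-as-if false true  c     d = refl
  or-as-if false false true  d = refl
  or-as-if false false false d = ∨-identityʳ d

runsQuestion-4Interval : ∀ m p rs → length rs ≡ 4 → Is4Interval m (runsQuestion m p rs)
runsQuestion-4Interval m p rs@(_ ∷ _ ∷ _ ∷ _ ∷ []) refl =
  any-4Interval m (map (cyclicInterval m) (askedRanges (toℕ p) rs)) refl

-- Answering a question that is constant on segments

record Segment (m : ℕ) : Set where
  constructor segment
  field
    positions : List (U m)
    asked     : Bool
    values    : List ℕ
open Segment

segmentsPositions : ∀ {m} → List (Segment m) → List (U m)
segmentsPositions = concatMap positions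

segmentsMask : ∀ {m} → List (Segment m) → List Bool
segmentsMask = concatMap (λ s → replicate (length (positions s)) (asked s))

length-segmentsMask : ∀ {m} (segs : List (Segment m)) → length (segmentsMask segs) ≡ length (segmentsPositions segs)
length-segmentsMask []         = refl
length-segmentsMask (s ∷ segs) =
  trans (length-++ (replicate (length (positions s)) (asked s)))
    (trans (cong₂ _+_ (length-replicate (length (positions s))) (length-segmentsMask segs))
           (sym (length-++ (positions s))))

module _ (m : ℕ) (σ : State m) (Q : Question m) where

  Constant : List (U m) → Bool → Set
  Constant xs b = map Q xs ≡ replicate (length xs) b

  Fits : Segment m → Set
  Fits s = Constant (positions s) (asked s) × support (map σ (positions s)) ≡ values s

  constant-segments : ∀ (segs : List (Segment m)) → map Q (segmentsPositions segs) ≡ segmentsMask segs →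
    All (λ s → Constant (positions s) (asked s)) segs
  constant-segments []         _  = []
  constant-segments (s ∷ segs) eq
    with ++-cancel-length (trans (sym (map-++ Q (positions s) _)) eq)
                          (trans (length-map Q (positions s)) (sym (length-replicate (length (positions s)))))
  ... | const , rest = const ∷ constant-segments segs rest

  map-if-constant : ∀ {b} (f g : U m → Fin 5) xs → Constant xs b →
    map (λ y → if Q y then f y else g y) xs ≡ map (λ y → if b then f y else g y) xs
  map-if-constant f g []       _  = refl
  map-if-constant f g (x ∷ xs) eq with Q x | ∷-injective eq
  ... | _ | refl , eq′ = cong (_ ∷_) (map-if-constant f g xs eq′)

  support-yes : ∀ {b} xs → Constant xs b →
    support (map (yesState m σ Q) xs) ≡ (if b then support (map σ xs) else raise (support (map σ xs)))
  support-yes {true}  xs eq = cong support (map-if-constant σ (bump ∘ σ) xs eq)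
  support-yes {false} xs eq = trans (cong support (trans (map-if-constant σ (bump ∘ σ) xs eq) (map-∘ xs)))
                                    (support-map-bump (map σ xs))

  support-no : ∀ {b} xs → Constant xs b →
    support (map (noState m σ Q) xs) ≡ (if b then raise (support (map σ xs)) else support (map σ xs))
  support-no {true}  xs eq = trans (cong support (trans (map-if-constant (bump ∘ σ) σ xs eq) (map-∘ xs)))
                                   (support-map-bump (map σ xs))
  support-no {false} xs eq = cong support (map-if-constant (bump ∘ σ) σ xs eq)

  filterᵇ-∧-constant : ∀ {b} (R : U m → Bool) xs → Constant xs b →
    filterᵇ (λ y → Q y ∧ R y) xs ≡ filterᵇ (λ y → b ∧ R y) xs
  filterᵇ-∧-constant R []       _  = refl
  filterᵇ-∧-constant {b} R (x ∷ xs) eq with Q x | ∷-injective eq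
  ... | _ | refl , eq′ with b ∧ R x
  ...   | true  = cong (x ∷_) (filterᵇ-∧-constant R xs eq′)
  ...   | false = filterᵇ-∧-constant R xs eq′

  filterᵇ-false : ∀ (xs : List (U m)) → filterᵇ (λ _ → false) xs ≡ []
  filterᵇ-false []       = refl
  filterᵇ-false (x ∷ xs) = filterᵇ-false xs

  askedCount : ∀ {b k} → k < 4 → ∀ xs → Constant xs b →
    length (filterᵇ (λ y → Q y ∧ (toℕ (σ y) ≡ᵇ k)) xs) ≡ (if b then count k (support (map σ xs)) else 0)
  askedCount {true}  k<4 xs eq =
    trans (cong length (filterᵇ-∧-constant _ xs eq)) (count-support m k<4 σ xs)
  askedCount {false} k<4 xs eq =
    cong length (trans (filterᵇ-∧-constant _ xs eq) (filterᵇ-false xs))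

  support-yes-segments : ∀ (segs : List (Segment m)) → All Fits segs →
    support (map (yesState m σ Q) (segmentsPositions segs)) ≡
    concatMap (λ s → if asked s then values s else raise (values s)) segs
  support-yes-segments []         []                  = refl
  support-yes-segments (s ∷ segs) ((const , vs) ∷ fits) =
    trans (support-map-++ m (yesState m σ Q) (positions s) _)
      (cong₂ _++_ (trans (support-yes (positions s) const) (cong (λ v → if asked s then v else raise v) vs))
                  (support-yes-segments segs fits))

  support-no-segments : ∀ (segs : List (Segment m)) → All Fits segs →
    support (map (noState m σ Q) (segmentsPositions segs)) ≡
    concatMap (λ s → if asked s then raise (values s) else values s) segs
  support-no-segments []         []                  = refl
  support-no-segments (s ∷ segs) ((const , vs) ∷ fits) =
    trans (support-map-++ m (noState m σ Q) (positions s) _)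
      (cong₂ _++_ (trans (support-no (positions s) const) (cong (λ v → if asked s then raise v else v) vs))
                  (support-no-segments segs fits))

  askedCount-segments : ∀ {k} → k < 4 → ∀ (segs : List (Segment m)) → All Fits segs →
    length (filterᵇ (λ y → Q y ∧ (toℕ (σ y) ≡ᵇ k)) (segmentsPositions segs)) ≡
    sum (map (λ s → if asked s then count k (values s) else 0) segs)
  askedCount-segments k<4 []         []                  = refl
  askedCount-segments k<4 (s ∷ segs) ((const , vs) ∷ fits) =
    trans (length-filterᵇ-++ _ (positions s) _)
      (cong₂ _+_ (trans (askedCount k<4 (positions s) const) (cong (λ v → if asked s then count _ v else 0) vs))
                 (askedCount-segments k<4 segs fits))

regroup-after-zero : ∀ (B D₁ C E D₂ F G D₃ H A : List ℕ) →
  (B ++ (D₁ ++ C) ++ E ++ (D₂ ++ F) ++ G ++ (D₃ ++ H) ++ []) ++ A ≡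
  B ++ D₁ ++ (C ++ E) ++ D₂ ++ (F ++ G) ++ D₃ ++ (H ++ A) ++ []
regroup-after-zero = solve 10 (λ B D₁ C E D₂ F G D₃ H A →
  (B ⊕ (D₁ ⊕ C) ⊕ E ⊕ (D₂ ⊕ F) ⊕ G ⊕ (D₃ ⊕ H) ⊕ ∅) ⊕ A ⊜
  B ⊕ D₁ ⊕ (C ⊕ E) ⊕ D₂ ⊕ (F ⊕ G) ⊕ D₃ ⊕ (H ⊕ A) ⊕ ∅) refl

regroup-no : ∀ (B C E F G H A : List ℕ) →
  B ++ (C ++ E) ++ (F ++ G) ++ (H ++ A) ++ [] ≡ (B ++ C ++ E ++ F ++ G ++ H ++ []) ++ A
regroup-no = solve 7 (λ B C E F G H A →
  B ⊕ (C ⊕ E) ⊕ (F ⊕ G) ⊕ (H ⊕ A) ⊕ ∅ ⊜ (B ⊕ C ⊕ E ⊕ F ⊕ G ⊕ H ⊕ ∅) ⊕ A) refl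

twosThrees-split : ∀ a b c′ e f′ g h′ d₁ d₂ d₃ →
  twosThrees b (d₁ + c′) e (d₂ + f′) g (d₃ + h′) ++ replicate a 2 ≡
  concat (replicate b 2 ∷ replicate d₁ 3 ∷ (replicate c′ 3 ++ replicate e 2) ∷ replicate d₂ 3 ∷
          (replicate f′ 3 ++ replicate g 2) ∷ replicate d₃ 3 ∷ (replicate h′ 3 ++ replicate a 2) ∷ [])
twosThrees-split a b c′ e f′ g h′ d₁ d₂ d₃
  rewrite replicate-+ d₁ c′ 3 | replicate-+ d₂ f′ 3 | replicate-+ d₃ h′ 3 =
  regroup-after-zero (replicate b 2) (replicate d₁ 3) (replicate c′ 3) (replicate e 2)
    (replicate d₂ 3) (replicate f′ 3) (replicate g 2) (replicate d₃ 3) (replicate h′ 3) (replicate a 2)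

split-≤-+ : ∀ {d x y} → d ≤ x + y → ∃ λ d₁ → ∃ λ d₂ → ∃ λ x′ → ∃ λ y′ →
  x ≡ d₁ + x′ × y ≡ d₂ + y′ × d ≡ d₁ + d₂
split-≤-+ {d} {x} {y} d≤x+y with d ≤? x
... | yes d≤x = d , 0 , x ∸ d , y , sym (m+[n∸m]≡n d≤x) , refl , sym (+-identityʳ d)
... | no  d≰x = x , d ∸ x , 0 , y ∸ (d ∸ x) , sym (+-identityʳ x) ,
                sym (m+[n∸m]≡n (m≤n+o⇒m∸n≤o d x d≤x+y)) , sym (m+[n∸m]≡n (<⇒≤ (≰⇒> d≰x)))

split-≤-+₃ : ∀ {d x y z} → d ≤ x + (y + z) → ∃ λ d₁ → ∃ λ d₂ → ∃ λ d₃ → ∃ λ x′ → ∃ λ y′ → ∃ λ z′ →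
  x ≡ d₁ + x′ × y ≡ d₂ + y′ × z ≡ d₃ + z′ × d ≡ d₁ + (d₂ + d₃)
split-≤-+₃ d≤ with split-≤-+ d≤
... | d₁ , d′ , x′ , yz′ , x≡ , yz≡ , d≡ with split-≤-+ (subst (d′ ≤_) (sym yz≡) (m≤m+n d′ yz′))
... | d₂ , d₃ , y′ , z′ , y≡ , z≡ , d′≡ = d₁ , d₂ , d₃ , x′ , y′ , z′ , x≡ , y≡ , z≡ , trans d≡ (cong (d₁ +_) d′≡)

GoodQuestion : (m : ℕ) → State m → ℕ → Set
GoodQuestion m σ d = Σ (Question m) λ Q →
  Is4Interval m Q × QHasType m σ Q 1 0 0 d × WellShaped m (yesState m σ Q) × WellShaped m (noState m σ Q)

yes-values-after-zero : ∀ a b c′ e f′ g h′ d₁ d₂ d₃ →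
  raise (replicate b 2) ++ replicate d₁ 3 ++ raise (replicate c′ 3 ++ replicate e 2) ++
  replicate d₂ 3 ++ raise (replicate f′ 3 ++ replicate g 2) ++
  replicate d₃ 3 ++ raise (replicate h′ 3 ++ replicate a 2) ++ [] ≡
  replicate (sum (b ∷ d₁ ∷ e ∷ d₂ ∷ g ∷ d₃ ∷ a ∷ [])) 3 ++ []
yes-values-after-zero a b c′ e f′ g h′ d₁ d₂ d₃
  rewrite raise-2s b | raise-3s-2s c′ e | raise-3s-2s f′ g | raise-3s-2s h′ a =
  trans (concat-replicate (b ∷ d₁ ∷ e ∷ d₂ ∷ g ∷ d₃ ∷ a ∷ []) 3) (sym (++-identityʳ _))

no-values-after-zero : ∀ a b c′ e f′ g h′ d₁ d₂ d₃ →
  replicate b 2 ++ raise (replicate d₁ 3) ++ (replicate c′ 3 ++ replicate e 2) ++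
  raise (replicate d₂ 3) ++ (replicate f′ 3 ++ replicate g 2) ++
  raise (replicate d₃ 3) ++ (replicate h′ 3 ++ replicate a 2) ++ [] ≡
  twosThrees b c′ e f′ g h′ ++ replicate a 2
no-values-after-zero a b c′ e f′ g h′ d₁ d₂ d₃ rewrite raise-3s d₁ | raise-3s d₂ | raise-3s d₃ =
  regroup-no (replicate b 2) (replicate c′ 3) (replicate e 2) (replicate f′ 3) (replicate g 2)
             (replicate h′ 3) (replicate a 2)

module PrefixQuestion (m : ℕ) (σ : State m) (p : U m) (σp≡0 : σ p ≡ 0F) (a b c′ e f′ g h′ d₁ d₂ d₃ : ℕ)
  (X₁ X₂ X₃ X₄ X₅ X₆ X₇ : List (U m)) (fromP : fromPosition m p ≡ p ∷ concat (X₁ ∷ X₂ ∷ X₃ ∷ X₄ ∷ X₅ ∷ X₆ ∷ X₇ ∷ []))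
  (v₁ : support (map σ X₁) ≡ replicate b 2) (v₂ : support (map σ X₂) ≡ replicate d₁ 3)
  (v₃ : support (map σ X₃) ≡ replicate c′ 3 ++ replicate e 2) (v₄ : support (map σ X₄) ≡ replicate d₂ 3)
  (v₅ : support (map σ X₅) ≡ replicate f′ 3 ++ replicate g 2) (v₆ : support (map σ X₆) ≡ replicate d₃ 3)
  (v₇ : support (map σ X₇) ≡ replicate h′ 3 ++ replicate a 2) where

  segs : List (Segment m)
  segs = segment (p ∷ []) true (0 ∷ []) ∷ segment X₁ false (replicate b 2) ∷
         segment X₂ true (replicate d₁ 3) ∷ segment X₃ false (replicate c′ 3 ++ replicate e 2) ∷
         segment X₄ true (replicate d₂ 3) ∷ segment X₅ false (replicate f′ 3 ++ replicate g 2) ∷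
         segment X₆ true (replicate d₃ 3) ∷ segment X₇ false (replicate h′ 3 ++ replicate a 2) ∷ []

  runs : List (ℕ × ℕ)
  runs = (1 , length X₁) ∷ (length X₂ , length X₃) ∷ (length X₄ , length X₅) ∷ (length X₆ , length X₇) ∷ []

  Q : Question m
  Q = runsQuestion m p runs

  runs-length : runsLength runs ≡ 2 ^ m
  runs-length = trans (sym (length-runsMask runs))
    (trans (length-segmentsMask segs) (trans (cong length (sym fromP)) (length-fromPosition m p)))

  fits : All (Fits m σ Q) segs
  fits = All.zip (constant-segments m σ Q segs (subst (λ xs → map Q xs ≡ segmentsMask segs) fromP
                                                       (map-runsQuestion m p runs runs-length)) ,
                  cong (λ v → support (v ∷ [])) σp≡0 ∷ v₁ ∷ v₂ ∷ v₃ ∷ v₄ ∷ v₅ ∷ v₆ ∷ v₇ ∷ [])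

  asked-count : ∀ {k} → k < 4 → qlevel m σ Q k ≡
    count k (0 ∷ []) + ((if 3 ≡ᵇ k then d₁ else 0) + ((if 3 ≡ᵇ k then d₂ else 0) + ((if 3 ≡ᵇ k then d₃ else 0) + 0)))
  asked-count {k} k<4 = begin
    qlevel m σ Q k
      ≡⟨ length-filterᵇ-rotation (λ y → Q y ∧ (toℕ (σ y) ≡ᵇ k)) (rotation-fromPosition m p) ⟩
    length (filterᵇ (λ y → Q y ∧ (toℕ (σ y) ≡ᵇ k)) (fromPosition m p))
      ≡⟨ cong (λ xs → length (filterᵇ (λ y → Q y ∧ (toℕ (σ y) ≡ᵇ k)) xs)) fromP ⟩
    length (filterᵇ (λ y → Q y ∧ (toℕ (σ y) ≡ᵇ k)) (segmentsPositions segs))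
      ≡⟨ askedCount-segments m σ Q k<4 segs fits ⟩
    count k (0 ∷ []) + (count k (replicate d₁ 3) + (count k (replicate d₂ 3) + (count k (replicate d₃ 3) + 0)))
      ≡⟨ cong (count k (0 ∷ []) +_) (cong₂ _+_ (count-replicate k d₁ 3)
           (cong₂ _+_ (count-replicate k d₂ 3) (cong (_+ 0) (count-replicate k d₃ 3)))) ⟩
    _ ∎
    where open ≡-Reasoning

  asked-type : QHasType m σ Q 1 0 0 (d₁ + (d₂ + d₃))
  asked-type = asked-count (s≤s z≤n) , asked-count (s≤s (s≤s z≤n)) , asked-count (s≤s (s≤s (s≤s z≤n))) ,
               trans (asked-count (s≤s (s≤s (s≤s (s≤s z≤n))))) (cong (λ z → d₁ + (d₂ + z)) (+-identityʳ d₃))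

  yes-shaped : WellShaped m (yesState m σ Q)
  yes-shaped = wellShaped-from m (yesState m σ Q) p
    (0 ∷ᵥ 0 ∷ᵥ 1 ∷ᵥ 0 ∷ᵥ 0 ∷ᵥ sum (b ∷ d₁ ∷ e ∷ d₂ ∷ g ∷ d₃ ∷ a ∷ []) ∷ᵥ
     0 ∷ᵥ 0 ∷ᵥ 0 ∷ᵥ 0 ∷ᵥ 0 ∷ᵥ 0 ∷ᵥ []ᵥ)
    (≡⇒rotation (trans (cong (λ xs → support (map (yesState m σ Q) xs)) fromP)
                       (trans (support-yes-segments m σ Q segs fits)
                              (cong (0 ∷_) (yes-values-after-zero a b c′ e f′ g h′ d₁ d₂ d₃)))))

  no-shaped : WellShaped m (noState m σ Q)
  no-shaped = wellShaped-from m (noState m σ Q) p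
    (a ∷ᵥ 1 ∷ᵥ 0 ∷ᵥ 0 ∷ᵥ b ∷ᵥ c′ ∷ᵥ e ∷ᵥ 0 ∷ᵥ 0 ∷ᵥ f′ ∷ᵥ g ∷ᵥ h′ ∷ᵥ []ᵥ)
    (subst (λ xs → Rotation xs (replicate a 2 ++ 1 ∷ twosThrees b c′ e f′ g h′)) (sym no-support)
           (rotation-swap (1 ∷ twosThrees b c′ e f′ g h′) (replicate a 2)))
    where
    no-support : support (map (noState m σ Q) (fromPosition m p)) ≡ (1 ∷ twosThrees b c′ e f′ g h′) ++ replicate a 2
    no-support = trans (cong (λ xs → support (map (noState m σ Q) xs)) fromP)
                       (trans (support-no-segments m σ Q segs fits)
                              (cong (1 ∷_) (no-values-after-zero a b c′ e f′ g h′ d₁ d₂ d₃)))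

  good : GoodQuestion m σ (d₁ + (d₂ + d₃))
  good = Q , runsQuestion-4Interval m p runs refl , asked-type , yes-shaped , no-shaped

question-asking-prefixes : ∀ m (σ : State m) p Z → σ p ≡ 0F → fromPosition m p ≡ p ∷ Z →
  ∀ a b c′ e f′ g h′ d₁ d₂ d₃ →
  support (map σ Z) ≡ twosThrees b (d₁ + c′) e (d₂ + f′) g (d₃ + h′) ++ replicate a 2 →
  GoodQuestion m σ (d₁ + (d₂ + d₃))
question-asking-prefixes m σ p Z σp≡0 fromP a b c′ e f′ g h′ d₁ d₂ d₃ supp
  with support-concat-split m σ Z (replicate b 2)
         (replicate d₁ 3 ∷ (replicate c′ 3 ++ replicate e 2) ∷ replicate d₂ 3 ∷ (replicate f′ 3 ++ replicate g 2) ∷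
          replicate d₃ 3 ∷ (replicate h′ 3 ++ replicate a 2) ∷ [])
         (trans supp (twosThrees-split a b c′ e f′ g h′ d₁ d₂ d₃))
... | X₁ ∷ X₂ ∷ X₃ ∷ X₄ ∷ X₅ ∷ X₆ ∷ X₇ ∷ [] , refl , v₁ ∷ v₂ ∷ v₃ ∷ v₄ ∷ v₅ ∷ v₆ ∷ v₇ ∷ [] =
  PrefixQuestion.good m σ p σp≡0 a b c′ e f′ g h′ d₁ d₂ d₃ X₁ X₂ X₃ X₄ X₅ X₆ X₇ fromP v₁ v₂ v₃ v₄ v₅ v₆ v₇

question-after-zero : ∀ m (σ : State m) p Z → σ p ≡ 0F → fromPosition m p ≡ p ∷ Z → ∀ a b c e f g h →
  Rotation (supportValues m σ) (replicate a 2 ++ 0 ∷ twosThrees b c e f g h) →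
  ∀ d → d ≤ c + (f + h) → GoodQuestion m σ d
question-after-zero m σ p Z σp≡0 fromP a b c e f g h rot d d≤ with split-≤-+₃ {x = c} {f} {h} d≤
... | d₁ , d₂ , d₃ , c′ , f′ , h′ , refl , refl , refl , refl =
  question-asking-prefixes m σ p Z σp≡0 fromP a b c′ e f′ g h′ d₁ d₂ d₃
    (support-after-zero m σ p Z σp≡0 fromP a b (d₁ + c′) e (d₂ + f′) g (d₃ + h′) rot)

lemma6 : (m : ℕ) (σ : State m) (d₃ : ℕ) →
    WellShaped m σ → HasType m σ 1 0 3 d₃ →
    (d : ℕ) → d ≤ d₃ →
    Σ (Question m) λ Q →
      Is4Interval m Q × QHasType m σ Q 1 0 0 d ×
      WellShaped m (yesState m σ Q) × WellShaped m (noState m σ Q)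
lemma6 m σ d₃ shaped (one-0 , no-1 , _ , three-d₃) d d≤d₃
  with zero-position m σ one-0
     | wellShaped-single-0-no-1 m σ shaped (trans (sym (level≡count m σ (s≤s z≤n))) one-0)
                                           (trans (sym (level≡count m σ (s≤s (s≤s z≤n)))) no-1)
... | p , σp≡0 | a , b , c , e , f , g , h , rot with fromPosition-head m p
... | Z , fromP = question-after-zero m σ p Z σp≡0 fromP a b c e f g h rot d
  (subst (d ≤_) (trans (sym three-d₃) (level-3-after-zero m σ a b c e f g h rot)) d≤d₃)
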